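{- For $n\ge 2$ let $f_n(t)=g_{n,\lfloor n/2\rfloor}(t)$, where $$g_{n,d}(t)=\sum_{i=1}^{\min(d,n-d)} \frac{(n-i-1)!}{(d-i)!\,(n-d-i)!\,(i-1)!}\, t^i,$$ and for $n\ge 3$ let $\mu_n=f_n'(1)/f_n(1)$ and $\sigma_n^2=f_n''(1)/f_n(1)+\mu_n-\mu_n^2$. Then for all $n\ge 3$, $$\sigma_n^2=\frac{\lceil n/2\rceil(\lceil n/2\rceil-1)}{4}-\frac{(\lceil n/2\rceil-1)(2\lfloor n/2\rfloor-1)}{4}\cdot\frac{f_{n-1}(1)}{f_n(1)}-\frac{(\lceil n/2\rceil-1)^2}{4}\left(\frac{f_{n-1}(1)}{f_n(1)}\right)^2.$$
   Context: $g_{n,d}$ is Speyer's $g$-polynomial of the uniform matroid $U_{n,d}$; primes denote derivatives in $t$. -}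

module Defs where

open import Data.Nat as ℕ using (ℕ; zero; suc; _∸_; ⌊_/2⌋; ⌈_/2⌉; _⊓_)
open import Data.Nat using (_!)
open import Data.Integer using (+_)
open import Data.Rational as ℚ using (ℚ; 0ℚ; 1ℚ; _+_; _*_; _-_; _÷_)
open import Data.Rational.Properties using (_≟_)
open import Data.List using (List; []; _∷_; map; upTo)
open import Relation.Nullary using (yes; no)

⟦_⟧ : ℕ → ℚ
⟦ n ⟧ = (+ n) ℚ./ 1

-- total division on ℚ (x / 0 := 0); only ever used with nonzero divisors here
_/'_ : ℚ → ℚ → ℚ
p /' q with q ≟ 0ℚ
... | yes _ = 0ℚ
... | no q≢0 = _÷_ p q {{ℚ.≢-nonZero q≢0}}

-- Polynomials over ℚ as coefficient lists [a₀, a₁, a₂, …] (a₀ + a₁ t + a₂ t² + …)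
Poly : Set
Poly = List ℚ

eval : Poly → ℚ → ℚ
eval [] x = 0ℚ
eval (a ∷ as) x = a + x * eval as x

derivFrom : ℕ → Poly → Poly
derivFrom k [] = []
derivFrom k (a ∷ as) = (⟦ k ⟧ * a) ∷ derivFrom (suc k) as

deriv : Poly → Poly
deriv [] = []
deriv (_ ∷ as) = derivFrom 1 as

gCoeff : ℕ → ℕ → ℕ → ℚ
gCoeff n d zero = 0ℚ
gCoeff n d (suc j) =
  ⟦ (n ∸ suc j ∸ 1) ! ⟧ /' ⟦ ((d ∸ suc j) !) ℕ.* ((n ∸ d ∸ suc j) !) ℕ.* (j !) ⟧

g : ℕ → ℕ → Poly
g n d = map (gCoeff n d) (upTo (suc (d ⊓ (n ∸ d))))

f : ℕ → Poly
f n = g n ⌊ n /2⌋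

μ : ℕ → ℚ
μ n = eval (deriv (f n)) 1ℚ /' eval (f n) 1ℚ

σ² : ℕ → ℚ
σ² n = (eval (deriv (deriv (f n))) 1ℚ /' eval (f n) 1ℚ) + μ n - μ n * μ n

-- Write γᵢ for the coefficient of tⁱ in g_{n,d}, γ′ᵢ for that of g_{n-1,d}, and κ = n - d.
-- Each γᵢ is a product of two binomial coefficients, so the absorption identities give
--   i (n-1-i) γ_{i+1} = (d-i)(κ-i) γᵢ   and   i γ_{i+1} + (κ-1) γ′ᵢ = (κ-i) γᵢ.
-- Summed over i both telescope, giving two linear relations at t = 1:
--   2 g″(1) + (dκ + n) g(1) = (2n-1) g′(1)   and   2 g′(1) + (κ-1) g_{n-1,d}(1) = (κ+1) g(1).
-- Eliminating g′(1)/g(1) and g″(1)/g(1) from σ² = g″(1)/g(1) + μ - μ² leaves a quadratic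
-- in r = g_{n-1,d}(1)/g(1), which is the stated one for c = κ.  For d = ⌊n/2⌋ the symmetry
-- g_{m,e} = g_{m,m-e} identifies g_{n-1,d} with f_{n-1}.

module Submission where

open import Defs
open import Data.Nat using (ℕ; _≤_; ⌊_/2⌋; ⌈_/2⌉; _∸_)
open import Data.Rational using (ℚ; 1ℚ; _+_; _-_; _*_)
open import Relation.Binary.PropositionalEquality using (_≡_)

open import Data.Nat as ℕ using (zero; suc; _<_; s≤s; z≤n; NonZero; _!)
import Data.Nat.Properties as ℕ
open import Data.Nat.Combinatorics using (_C_; nCk≡n!/k![n-k]!; k![n∸k]!∣n!; k>n⇒nCk≡0; [n-k]*[n-k-1]!≡[n-k]!)
open import Data.Nat.DivMod using (_/_; m/n*n≡m)
open import Data.Nat.Tactic.RingSolver using () renaming (solve-∀ to ℕ-solve-∀)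
import Data.Integer as ℤ
open import Data.Integer.Tactic.RingSolver using () renaming (solve-∀ to ℤ-solve-∀)
open import Data.Rational as ℚ using (0ℚ; 1/_)
import Data.Rational.Properties as ℚ
import Data.Rational.Unnormalised as ℚᵘ
import Data.Rational.Unnormalised.Properties as ℚᵘ
open import Data.List using (_∷_; map; applyUpTo; upTo)
open import Data.List.Properties using (map-applyUpTo; map-cong)
open import Data.Maybe using (Maybe; just; nothing)
open import Data.Sum using (inj₁; inj₂)
open import Function using (_∘_; id)
open import Level using (0ℓ)
open import Relation.Binary.PropositionalEquality
  using (refl; sym; trans; cong; cong₂; subst; module ≡-Reasoning)
open import Relation.Nullary using (yes; no; contradiction)
import Tactic.RingSolver.Core.AlmostCommutativeRing as ACR
open import Tactic.RingSolver using (solve-∀)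

ℚ-ring : ACR.AlmostCommutativeRing 0ℓ 0ℓ
ℚ-ring = ACR.fromCommutativeRing ℚ.+-*-commutativeRing 0≟
  where
  0≟ : (x : ℚ) → Maybe (0ℚ ≡ x)
  0≟ x with 0ℚ ℚ.≟ x
  ... | yes p = just p
  ... | no _ = nothing

⟦suc⟧ : ∀ n → ⟦ suc n ⟧ ≡ 1ℚ + ⟦ n ⟧
⟦suc⟧ n = ℚ.toℚᵘ-injective (begin
  ℚ.toℚᵘ ⟦ suc n ⟧                  ≈⟨ ℚ.toℚᵘ-fromℚᵘ (ℚᵘ.mkℚᵘ (ℤ.+ suc n) 0) ⟩
  ℚᵘ.mkℚᵘ (ℤ.+ suc n) 0             ≈⟨ ℚᵘ.*≡* (cross-multiply (ℤ.+ n)) ⟨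
  ℚ.toℚᵘ 1ℚ ℚᵘ.+ ℚᵘ.mkℚᵘ (ℤ.+ n) 0  ≈⟨ ℚᵘ.+-congʳ (ℚ.toℚᵘ 1ℚ) (ℚ.toℚᵘ-fromℚᵘ (ℚᵘ.mkℚᵘ (ℤ.+ n) 0)) ⟨
  ℚ.toℚᵘ 1ℚ ℚᵘ.+ ℚ.toℚᵘ ⟦ n ⟧       ≈⟨ ℚ.toℚᵘ-homo-+ 1ℚ ⟦ n ⟧ ⟨
  ℚ.toℚᵘ (1ℚ + ⟦ n ⟧)               ∎)
  where
  open ℚᵘ.≃-Reasoning
  cross-multiply : ∀ m → (ℤ.+ 1 ℤ.* ℤ.+ 1 ℤ.+ m ℤ.* ℤ.+ 1) ℤ.* ℤ.+ 1 ≡ (ℤ.+ 1 ℤ.+ m) ℤ.* (ℤ.+ 1 ℤ.* ℤ.+ 1)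
  cross-multiply = ℤ-solve-∀

⟦+⟧ : ∀ m n → ⟦ m ℕ.+ n ⟧ ≡ ⟦ m ⟧ + ⟦ n ⟧
⟦+⟧ zero n = sym (ℚ.+-identityˡ ⟦ n ⟧)
⟦+⟧ (suc m) n = begin
  ⟦ suc (m ℕ.+ n) ⟧     ≡⟨ ⟦suc⟧ (m ℕ.+ n) ⟩
  1ℚ + ⟦ m ℕ.+ n ⟧      ≡⟨ cong (1ℚ +_) (⟦+⟧ m n) ⟩
  1ℚ + (⟦ m ⟧ + ⟦ n ⟧)  ≡⟨ ℚ.+-assoc 1ℚ ⟦ m ⟧ ⟦ n ⟧ ⟨
  1ℚ + ⟦ m ⟧ + ⟦ n ⟧    ≡⟨ cong (_+ ⟦ n ⟧) (⟦suc⟧ m) ⟨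
  ⟦ suc m ⟧ + ⟦ n ⟧     ∎
  where open ≡-Reasoning

⟦*⟧ : ∀ m n → ⟦ m ℕ.* n ⟧ ≡ ⟦ m ⟧ * ⟦ n ⟧
⟦*⟧ zero n = sym (ℚ.*-zeroˡ ⟦ n ⟧)
⟦*⟧ (suc m) n = begin
  ⟦ n ℕ.+ m ℕ.* n ⟧           ≡⟨ ⟦+⟧ n (m ℕ.* n) ⟩
  ⟦ n ⟧ + ⟦ m ℕ.* n ⟧         ≡⟨ cong (⟦ n ⟧ +_) (⟦*⟧ m n) ⟩
  ⟦ n ⟧ + ⟦ m ⟧ * ⟦ n ⟧       ≡⟨ cong (_+ ⟦ m ⟧ * ⟦ n ⟧) (ℚ.*-identityˡ ⟦ n ⟧) ⟨
  1ℚ * ⟦ n ⟧ + ⟦ m ⟧ * ⟦ n ⟧  ≡⟨ ℚ.*-distribʳ-+ ⟦ n ⟧ 1ℚ ⟦ m ⟧ ⟨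
  (1ℚ + ⟦ m ⟧) * ⟦ n ⟧        ≡⟨ cong (_* ⟦ n ⟧) (⟦suc⟧ m) ⟨
  ⟦ suc m ⟧ * ⟦ n ⟧           ∎
  where open ≡-Reasoning

⟦*⟧₃ : ∀ x y z → ⟦ x ℕ.* y ℕ.* z ⟧ ≡ ⟦ x ⟧ * ⟦ y ⟧ * ⟦ z ⟧
⟦*⟧₃ x y z = trans (⟦*⟧ (x ℕ.* y) z) (cong (_* ⟦ z ⟧) (⟦*⟧ x y))

⟦∸⟧ : ∀ {m n} → n ≤ m → ⟦ m ∸ n ⟧ ≡ ⟦ m ⟧ - ⟦ n ⟧
⟦∸⟧ {m} {n} n≤m = begin
  ⟦ m ∸ n ⟧                  ≡⟨ cancel ⟦ m ∸ n ⟧ ⟦ n ⟧ ⟩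
  ⟦ n ⟧ + ⟦ m ∸ n ⟧ - ⟦ n ⟧  ≡⟨ cong (_- ⟦ n ⟧) (⟦+⟧ n (m ∸ n)) ⟨
  ⟦ n ℕ.+ (m ∸ n) ⟧ - ⟦ n ⟧  ≡⟨ cong (λ k → ⟦ k ⟧ - ⟦ n ⟧) (ℕ.m+[n∸m]≡n n≤m) ⟩
  ⟦ m ⟧ - ⟦ n ⟧              ∎
  where
  open ≡-Reasoning
  cancel : ∀ x y → x ≡ y + x - y
  cancel = solve-∀ ℚ-ring

⟦⟧-pos : ∀ n .{{_ : NonZero n}} → 0ℚ ℚ.< ⟦ n ⟧
⟦⟧-pos n = ℚ.positive⁻¹ ⟦ n ⟧ {{ℚ.normalize-pos n 1}}

⟦⟧-nonNeg : ∀ n → 0ℚ ℚ.≤ ⟦ n ⟧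
⟦⟧-nonNeg n = ℚ.nonNegative⁻¹ ⟦ n ⟧ {{ℚ.normalize-nonNeg n 1}}

/'≡*1/ : ∀ {q} p (q>0 : 0ℚ ℚ.< q) → p /' q ≡ p * (1/ q) {{ℚ.>-nonZero q>0}}
/'≡*1/ {q} p q>0 with q ℚ.≟ 0ℚ
... | yes q≡0 = contradiction (sym q≡0) (ℚ.<⇒≢ q>0)
... | no _ = refl

⟦m*n⟧/'⟦n⟧≡⟦m⟧ : ∀ m n .{{_ : NonZero n}} → ⟦ m ℕ.* n ⟧ /' ⟦ n ⟧ ≡ ⟦ m ⟧
⟦m*n⟧/'⟦n⟧≡⟦m⟧ m n = begin
  ⟦ m ℕ.* n ⟧ /' ⟦ n ⟧          ≡⟨ /'≡*1/ ⟦ m ℕ.* n ⟧ (⟦⟧-pos n) ⟩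
  ⟦ m ℕ.* n ⟧ * (1/ ⟦ n ⟧)      ≡⟨ cong (_* (1/ ⟦ n ⟧)) (⟦*⟧ m n) ⟩
  ⟦ m ⟧ * ⟦ n ⟧ * (1/ ⟦ n ⟧)    ≡⟨ ℚ.*-assoc ⟦ m ⟧ ⟦ n ⟧ _ ⟩
  ⟦ m ⟧ * (⟦ n ⟧ * (1/ ⟦ n ⟧))  ≡⟨ cong (⟦ m ⟧ *_) (ℚ.*-inverseʳ ⟦ n ⟧) ⟩
  ⟦ m ⟧ * 1ℚ                    ≡⟨ ℚ.*-identityʳ ⟦ m ⟧ ⟩
  ⟦ m ⟧                         ∎
  where
  open ≡-Reasoning
  instance _ = ℚ.>-nonZero (⟦⟧-pos n)

-- Binomial coefficients

nCk*[k!*[n∸k]!]≡n! : ∀ {n k} → k ≤ n → (n C k) ℕ.* (k ! ℕ.* (n ∸ k) !) ≡ n !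
nCk*[k!*[n∸k]!]≡n! {n} {k} k≤n = begin
  (n C k) ℕ.* (k ! ℕ.* (n ∸ k) !)                    ≡⟨ cong (ℕ._* (k ! ℕ.* (n ∸ k) !)) (nCk≡n!/k![n-k]! k≤n) ⟩
  n ! / (k ! ℕ.* (n ∸ k) !) ℕ.* (k ! ℕ.* (n ∸ k) !)  ≡⟨ m/n*n≡m (k![n∸k]!∣n! k≤n) ⟩
  n !                                                ∎
  where
  open ≡-Reasoning
  instance _ = k ℕ.!* (n ∸ k) !≢0

[n∸k]*nCk*[k!*[n∸1+k]!]≡n! : ∀ {n k} → k < n → (n ∸ k) ℕ.* (n C k) ℕ.* (k ! ℕ.* (n ∸ suc k) !) ≡ n !
[n∸k]*nCk*[k!*[n∸1+k]!]≡n! {n} {k} k<n = begin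
  (n ∸ k) ℕ.* (n C k) ℕ.* (k ! ℕ.* (n ∸ suc k) !)
    ≡⟨ regroup (n ∸ k) (n C k) (k !) ((n ∸ suc k) !) ⟩
  (n C k) ℕ.* (k ! ℕ.* ((n ∸ k) ℕ.* (n ∸ suc k) !))
    ≡⟨ cong (λ x → (n C k) ℕ.* (k ! ℕ.* x)) ([n-k]*[n-k-1]!≡[n-k]! k<n) ⟩
  (n C k) ℕ.* (k ! ℕ.* (n ∸ k) !)
    ≡⟨ nCk*[k!*[n∸k]!]≡n! (ℕ.<⇒≤ k<n) ⟩
  n ! ∎
  where
  open ≡-Reasoning
  regroup : ∀ a c f g → a ℕ.* c ℕ.* (f ℕ.* g) ≡ c ℕ.* (f ℕ.* (a ℕ.* g))
  regroup = ℕ-solve-∀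

[1+k]*nC[1+k]≡[n∸k]*nCk : ∀ n k → suc k ℕ.* (n C suc k) ≡ (n ∸ k) ℕ.* (n C k)
[1+k]*nC[1+k]≡[n∸k]*nCk n k with k ℕ.<? n
... | yes k<n = ℕ.*-cancelʳ-≡ _ _ (k ! ℕ.* (n ∸ suc k) !) {{k ℕ.!* (n ∸ suc k) !≢0}} (begin
  suc k ℕ.* (n C suc k) ℕ.* (k ! ℕ.* (n ∸ suc k) !)  ≡⟨ regroup (suc k) (n C suc k) (k !) ((n ∸ suc k) !) ⟩
  (n C suc k) ℕ.* (suc k ! ℕ.* (n ∸ suc k) !)        ≡⟨ nCk*[k!*[n∸k]!]≡n! k<n ⟩
  n !                                                ≡⟨ [n∸k]*nCk*[k!*[n∸1+k]!]≡n! k<n ⟨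
  (n ∸ k) ℕ.* (n C k) ℕ.* (k ! ℕ.* (n ∸ suc k) !)    ∎)
  where
  open ≡-Reasoning
  regroup : ∀ a c f g → a ℕ.* c ℕ.* (f ℕ.* g) ≡ c ℕ.* (a ℕ.* f ℕ.* g)
  regroup = ℕ-solve-∀
... | no k≮n rewrite k>n⇒nCk≡0 (s≤s (ℕ.≮⇒≥ k≮n)) | ℕ.m≤n⇒m∸n≡0 (ℕ.≮⇒≥ k≮n) = ℕ.*-zeroʳ (suc k)

n*[n-1]Ck≡[n∸k]*nCk : ∀ n k → n ℕ.* (ℕ.pred n C k) ≡ (n ∸ k) ℕ.* (n C k)
n*[n-1]Ck≡[n∸k]*nCk zero k = sym (cong (ℕ._* (zero C k)) (ℕ.0∸n≡0 k))
n*[n-1]Ck≡[n∸k]*nCk (suc m) k with k ℕ.≤? m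
... | yes k≤m = ℕ.*-cancelʳ-≡ _ _ (k ! ℕ.* (m ∸ k) !) {{k ℕ.!* (m ∸ k) !≢0}} (begin
  suc m ℕ.* (m C k) ℕ.* (k ! ℕ.* (m ∸ k) !)            ≡⟨ ℕ.*-assoc (suc m) (m C k) _ ⟩
  suc m ℕ.* ((m C k) ℕ.* (k ! ℕ.* (m ∸ k) !))          ≡⟨ cong (suc m ℕ.*_) (nCk*[k!*[n∸k]!]≡n! k≤m) ⟩
  suc m !                                              ≡⟨ [n∸k]*nCk*[k!*[n∸1+k]!]≡n! (s≤s k≤m) ⟨
  (suc m ∸ k) ℕ.* (suc m C k) ℕ.* (k ! ℕ.* (m ∸ k) !)  ∎)
  where open ≡-Reasoning
... | no k≰m rewrite k>n⇒nCk≡0 (ℕ.≰⇒> k≰m) | ℕ.m≤n⇒m∸n≡0 (ℕ.≰⇒> k≰m) = ℕ.*-zeroʳ (suc m)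

∑ : ℕ → (ℕ → ℚ) → ℚ
∑ zero    f = 0ℚ
∑ (suc n) f = ∑ n f + f n

syntax ∑ n (λ i → e) = ∑[ i < n ] e

∑-cong : ∀ {f h} n → (∀ i → i < n → f i ≡ h i) → ∑ n f ≡ ∑ n h
∑-cong zero    eq = refl
∑-cong (suc n) eq = cong₂ _+_ (∑-cong n (λ i i<n → eq i (ℕ.m<n⇒m<1+n i<n))) (eq n ℕ.≤-refl)

∑-+ : ∀ n (f h : ℕ → ℚ) → ∑[ i < n ] (f i + h i) ≡ ∑ n f + ∑ n h
∑-+ zero    f h = sym (ℚ.+-identityˡ 0ℚ)
∑-+ (suc n) f h = trans (cong (_+ (f n + h n)) (∑-+ n f h)) (interchange (∑ n f) (∑ n h) (f n) (h n))
  where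
  interchange : ∀ x y z w → x + y + (z + w) ≡ x + z + (y + w)
  interchange = solve-∀ ℚ-ring

∑-*ˡ : ∀ n c (f : ℕ → ℚ) → ∑[ i < n ] (c * f i) ≡ c * ∑ n f
∑-*ˡ zero    c f = sym (ℚ.*-zeroʳ c)
∑-*ˡ (suc n) c f = trans (cong (_+ c * f n) (∑-*ˡ n c f)) (sym (ℚ.*-distribˡ-+ c (∑ n f) (f n)))

∑-peel : ∀ n (f : ℕ → ℚ) → ∑ (suc n) f ≡ f 0 + ∑[ i < n ] f (suc i)
∑-peel zero    f = ℚ.+-comm 0ℚ (f 0)
∑-peel (suc n) f = trans (cong (_+ f (suc n)) (∑-peel n f)) (ℚ.+-assoc (f 0) _ _)

∑-peel-zero : ∀ n (f : ℕ → ℚ) → f 0 ≡ 0ℚ → ∑ (suc n) f ≡ ∑[ i < n ] f (suc i)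
∑-peel-zero n f f0≡0 = trans (∑-peel n f) (trans (cong (_+ ∑[ i < n ] f (suc i)) f0≡0) (ℚ.+-identityˡ _))

∑-telescope : ∀ n (f : ℕ → ℚ) → ∑[ i < n ] (f (suc i) - f i) ≡ f n - f 0
∑-telescope zero    f = sym (ℚ.+-inverseʳ (f 0))
∑-telescope (suc n) f =
  trans (cong (_+ (f (suc n) - f n)) (∑-telescope n f)) (collapse (f n) (f 0) (f (suc n)))
  where
  collapse : ∀ x y z → x - y + (z - x) ≡ z - y
  collapse = solve-∀ ℚ-ring

∑-telescoping-cong : ∀ n {u v : ℕ → ℚ} (F : ℕ → ℚ) → F 0 ≡ 0ℚ → F n ≡ 0ℚ →
  (∀ i → i < n → u i ≡ v i + (F (suc i) - F i)) → ∑ n u ≡ ∑ n v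
∑-telescoping-cong n {u} {v} F F0≡0 Fn≡0 u≡v+ΔF = begin
  ∑ n u                                 ≡⟨ ∑-cong n u≡v+ΔF ⟩
  ∑[ i < n ] (v i + (F (suc i) - F i))  ≡⟨ ∑-+ n v (λ i → F (suc i) - F i) ⟩
  ∑ n v + ∑[ i < n ] (F (suc i) - F i)  ≡⟨ cong (∑ n v +_) (∑-telescope n F) ⟩
  ∑ n v + (F n - F 0)                   ≡⟨ cong₂ (λ x y → ∑ n v + (x - y)) Fn≡0 F0≡0 ⟩
  ∑ n v + (0ℚ - 0ℚ)                     ≡⟨ ℚ.+-identityʳ (∑ n v) ⟩
  ∑ n v                                 ∎
  where open ≡-Reasoning

∑-vanishing-tail : ∀ {m f} → (∀ i → m ≤ i → f i ≡ 0ℚ) → ∀ n → m ≤ n → ∑ n f ≡ ∑ m f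
∑-vanishing-tail {m} {f} f≡0 n m≤n with ℕ.m≤n⇒m<n∨m≡n m≤n
... | inj₂ refl = refl
∑-vanishing-tail {m} {f} f≡0 (suc n) m≤n | inj₁ (s≤s m≤n′) =
  trans (cong₂ _+_ (∑-vanishing-tail f≡0 n m≤n′) (f≡0 n m≤n′)) (ℚ.+-identityʳ (∑ m f))

∑-pos : ∀ {f k} → (∀ i → 0ℚ ℚ.≤ f i) → 0ℚ ℚ.< f k → ∀ n → k < n → 0ℚ ℚ.< ∑ n f
∑-pos {f} {k} f≥0 fk>0 (suc n) k<1+n with ℕ.m≤n⇒m<n∨m≡n (ℕ.≤-pred k<1+n)
... | inj₁ k<n  = ℚ.+-mono-<-≤ (∑-pos f≥0 fk>0 n k<n) (f≥0 n)
... | inj₂ refl = ℚ.+-mono-≤-< (∑-nonNeg n) fk>0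
  where
  ∑-nonNeg : ∀ m → 0ℚ ℚ.≤ ∑ m f
  ∑-nonNeg zero    = ℚ.≤-refl
  ∑-nonNeg (suc m) = ℚ.+-mono-≤ (∑-nonNeg m) (f≥0 m)

applyUpTo-cong : ∀ {A : Set} {f h : ℕ → A} n → (∀ i → i < n → f i ≡ h i) → applyUpTo f n ≡ applyUpTo h n
applyUpTo-cong zero    eq = refl
applyUpTo-cong (suc n) eq = cong₂ _∷_ (eq 0 (s≤s z≤n)) (applyUpTo-cong n (λ i i<n → eq (suc i) (s≤s i<n)))

derivFrom-applyUpTo : ∀ k h n → derivFrom k (applyUpTo h n) ≡ applyUpTo (λ i → ⟦ k ℕ.+ i ⟧ * h i) n
derivFrom-applyUpTo k h zero    = refl
derivFrom-applyUpTo k h (suc n) = cong₂ _∷_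
  (cong (λ m → ⟦ m ⟧ * h 0) (sym (ℕ.+-identityʳ k)))
  (trans (derivFrom-applyUpTo (suc k) (h ∘ suc) n)
         (applyUpTo-cong n (λ i _ → cong (λ m → ⟦ m ⟧ * h (suc i)) (sym (ℕ.+-suc k i)))))

deriv-applyUpTo : ∀ h n → deriv (applyUpTo h n) ≡ applyUpTo (λ i → ⟦ suc i ⟧ * h (suc i)) (ℕ.pred n)
deriv-applyUpTo h zero    = refl
deriv-applyUpTo h (suc n) = derivFrom-applyUpTo 1 (h ∘ suc) n

eval-applyUpTo : ∀ h n → eval (applyUpTo h n) 1ℚ ≡ ∑ n h
eval-applyUpTo h zero    = refl
eval-applyUpTo h (suc n) = begin
  h 0 + 1ℚ * eval (applyUpTo (h ∘ suc) n) 1ℚ  ≡⟨ cong (h 0 +_) (ℚ.*-identityˡ _) ⟩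
  h 0 + eval (applyUpTo (h ∘ suc) n) 1ℚ       ≡⟨ cong (h 0 +_) (eval-applyUpTo (h ∘ suc) n) ⟩
  h 0 + ∑[ i < n ] h (suc i)                  ≡⟨ ∑-peel n h ⟨
  ∑ (suc n) h                                 ∎
  where open ≡-Reasoning

eval-deriv-applyUpTo : ∀ h n → eval (deriv (applyUpTo h n)) 1ℚ ≡ ∑[ i < n ] (⟦ i ⟧ * h i)
eval-deriv-applyUpTo h zero    = refl
eval-deriv-applyUpTo h (suc n) = begin
  eval (deriv (applyUpTo h (suc n))) 1ℚ                ≡⟨ cong (λ p → eval p 1ℚ) (deriv-applyUpTo h (suc n)) ⟩
  eval (applyUpTo (λ i → ⟦ suc i ⟧ * h (suc i)) n) 1ℚ  ≡⟨ eval-applyUpTo _ n ⟩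
  ∑[ i < n ] (⟦ suc i ⟧ * h (suc i))                   ≡⟨ ∑-peel-zero n (λ i → ⟦ i ⟧ * h i) (ℚ.*-zeroˡ (h 0)) ⟨
  ∑[ i < suc n ] (⟦ i ⟧ * h i)                         ∎
  where open ≡-Reasoning

eval-deriv²-applyUpTo : ∀ h n →
  eval (deriv (deriv (applyUpTo h n))) 1ℚ ≡ ∑[ i < n ] (⟦ i ⟧ * (⟦ i ⟧ - 1ℚ) * h i)
eval-deriv²-applyUpTo h zero    = refl
eval-deriv²-applyUpTo h (suc n) = begin
  eval (deriv (deriv (applyUpTo h (suc n)))) 1ℚ
    ≡⟨ cong (λ p → eval (deriv p) 1ℚ) (deriv-applyUpTo h (suc n)) ⟩
  eval (deriv (applyUpTo (λ i → ⟦ suc i ⟧ * h (suc i)) n)) 1ℚ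
    ≡⟨ eval-deriv-applyUpTo _ n ⟩
  ∑[ i < n ] (⟦ i ⟧ * (⟦ suc i ⟧ * h (suc i)))
    ≡⟨ ∑-cong n (λ i _ → falling i (h (suc i))) ⟩
  ∑[ i < n ] (⟦ suc i ⟧ * (⟦ suc i ⟧ - 1ℚ) * h (suc i))
    ≡⟨ ∑-peel-zero n (λ i → ⟦ i ⟧ * (⟦ i ⟧ - 1ℚ) * h i) (ℚ.*-zeroˡ (h 0)) ⟨
  ∑[ i < suc n ] (⟦ i ⟧ * (⟦ i ⟧ - 1ℚ) * h i) ∎
  where
  open ≡-Reasoning
  falling : ∀ i y → ⟦ i ⟧ * (⟦ suc i ⟧ * y) ≡ ⟦ suc i ⟧ * (⟦ suc i ⟧ - 1ℚ) * y
  falling i y = begin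
    ⟦ i ⟧ * (⟦ suc i ⟧ * y)               ≡⟨ cong (λ s → ⟦ i ⟧ * (s * y)) (⟦suc⟧ i) ⟩
    ⟦ i ⟧ * ((1ℚ + ⟦ i ⟧) * y)            ≡⟨ expand ⟦ i ⟧ y ⟩
    (1ℚ + ⟦ i ⟧) * (1ℚ + ⟦ i ⟧ - 1ℚ) * y  ≡⟨ cong (λ s → s * (s - 1ℚ) * y) (⟦suc⟧ i) ⟨
    ⟦ suc i ⟧ * (⟦ suc i ⟧ - 1ℚ) * y      ∎
    where
    expand : ∀ x y → x * ((1ℚ + x) * y) ≡ (1ℚ + x) * (1ℚ + x - 1ℚ) * y
    expand = solve-∀ ℚ-ring

-- γ a b i is the coefficient of tⁱ in g_{a+b+2,a+1}, i.e. (a+b+1-i)!/((a+1-i)! (b+1-i)! (i-1)!)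
-- for 1 ≤ i ≤ min(a,b)+1.  As a product of binomials it vanishes outside that range, which
-- makes the recurrences below hold for every i.
γ : ℕ → ℕ → ℕ → ℕ
γ a b zero    = 0
γ a b (suc j) = ((a ℕ.+ b ∸ j) C a) ℕ.* (a C j)

a+b∸j∸a≡b∸j : ∀ a b j → a ℕ.+ b ∸ j ∸ a ≡ b ∸ j
a+b∸j∸a≡b∸j a b j = begin
  a ℕ.+ b ∸ j ∸ a      ≡⟨ ℕ.∸-+-assoc (a ℕ.+ b) j a ⟩
  a ℕ.+ b ∸ (j ℕ.+ a)  ≡⟨ cong (a ℕ.+ b ∸_) (ℕ.+-comm j a) ⟩
  a ℕ.+ b ∸ (a ℕ.+ j)  ≡⟨ ℕ.[m+n]∸[m+o]≡n∸o a b j ⟩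
  b ∸ j                ∎
  where open ≡-Reasoning

γ-factorial : ∀ {a b j} → j ≤ a → j ≤ b →
  γ a b (suc j) ℕ.* ((a ∸ j) ! ℕ.* (b ∸ j) ! ℕ.* j !) ≡ (a ℕ.+ b ∸ j) !
γ-factorial {a} {b} {j} j≤a j≤b = begin
  ((M C a) ℕ.* (a C j)) ℕ.* ((a ∸ j) ! ℕ.* (b ∸ j) ! ℕ.* j !)
    ≡⟨ regroup (M C a) (a C j) ((a ∸ j) !) ((b ∸ j) !) (j !) ⟩
  (M C a) ℕ.* ((a C j) ℕ.* (j ! ℕ.* (a ∸ j) !) ℕ.* (b ∸ j) !)
    ≡⟨ cong (λ x → (M C a) ℕ.* (x ℕ.* (b ∸ j) !)) (nCk*[k!*[n∸k]!]≡n! j≤a) ⟩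
  (M C a) ℕ.* (a ! ℕ.* (b ∸ j) !)
    ≡⟨ cong (λ x → (M C a) ℕ.* (a ! ℕ.* x !)) (a+b∸j∸a≡b∸j a b j) ⟨
  (M C a) ℕ.* (a ! ℕ.* (M ∸ a) !)
    ≡⟨ nCk*[k!*[n∸k]!]≡n! a≤M ⟩
  M ! ∎
  where
  open ≡-Reasoning
  M = a ℕ.+ b ∸ j
  a≤M : a ≤ M
  a≤M = subst (a ≤_) (sym (ℕ.+-∸-assoc a j≤b)) (ℕ.m≤m+n a (b ∸ j))
  regroup : ∀ c c′ x y z → c ℕ.* c′ ℕ.* (x ℕ.* y ℕ.* z) ≡ c ℕ.* (c′ ℕ.* (z ℕ.* x) ℕ.* y)
  regroup = ℕ-solve-∀

γ-1≢0 : ∀ a b → NonZero (γ a b 1)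
γ-1≢0 a b = ℕ.m*n≢0⇒m≢0 (γ a b 1) {{subst NonZero (sym (γ-factorial {a} {b} z≤n z≤n)) ((a ℕ.+ b ∸ 0) ℕ.!≢0)}}

γ-vanishes : ∀ {a b i} → suc (a ℕ.⊓ b) < i → γ a b i ≡ 0
γ-vanishes {a} {b} {suc j} (s≤s a⊓b<j) with j ℕ.≤? a
... | no j≰a = trans (cong (((a ℕ.+ b ∸ j) C a) ℕ.*_) (k>n⇒nCk≡0 (ℕ.≰⇒> j≰a))) (ℕ.*-zeroʳ ((a ℕ.+ b ∸ j) C a))
... | yes j≤a = cong (ℕ._* (a C j)) (k>n⇒nCk≡0 (begin-strict
    a ℕ.+ b ∸ j  <⟨ ℕ.∸-monoʳ-< b<j (ℕ.≤-trans j≤a (ℕ.m≤m+n a b)) ⟩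
    a ℕ.+ b ∸ b  ≡⟨ ℕ.m+n∸n≡m a b ⟩
    a            ∎))
  where
  open ℕ.≤-Reasoning
  b<j : b < j
  b<j = ℕ.≰⇒> (λ j≤b → ℕ.<⇒≱ a⊓b<j (ℕ.⊓-glb j≤a j≤b))

γ-ratio : ∀ a b i → i ℕ.* (suc (a ℕ.+ b) ∸ i) ℕ.* γ a b (suc i) ≡ (suc a ∸ i) ℕ.* (suc b ∸ i) ℕ.* γ a b i
γ-ratio a b zero    = sym (ℕ.*-zeroʳ (suc a ℕ.* suc b))
γ-ratio a b (suc j) = begin
  suc j ℕ.* M ℕ.* ((pred-M C a) ℕ.* (a C suc j))
    ≡⟨ regroup (suc j) M (pred-M C a) (a C suc j) ⟩
  M ℕ.* (pred-M C a) ℕ.* (suc j ℕ.* (a C suc j))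
    ≡⟨ cong (λ x → M ℕ.* (x C a) ℕ.* (suc j ℕ.* (a C suc j))) (ℕ.pred[m∸n]≡m∸[1+n] (a ℕ.+ b) j) ⟨
  M ℕ.* (ℕ.pred M C a) ℕ.* (suc j ℕ.* (a C suc j))
    ≡⟨ cong₂ ℕ._*_ (n*[n-1]Ck≡[n∸k]*nCk M a) ([1+k]*nC[1+k]≡[n∸k]*nCk a j) ⟩
  (M ∸ a) ℕ.* (M C a) ℕ.* ((a ∸ j) ℕ.* (a C j))
    ≡⟨ cong (λ x → x ℕ.* (M C a) ℕ.* ((a ∸ j) ℕ.* (a C j))) (a+b∸j∸a≡b∸j a b j) ⟩
  (b ∸ j) ℕ.* (M C a) ℕ.* ((a ∸ j) ℕ.* (a C j))
    ≡⟨ regroup′ (b ∸ j) (M C a) (a ∸ j) (a C j) ⟩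
  (a ∸ j) ℕ.* (b ∸ j) ℕ.* ((M C a) ℕ.* (a C j)) ∎
  where
  open ≡-Reasoning
  M = a ℕ.+ b ∸ j
  pred-M = a ℕ.+ b ∸ suc j
  regroup : ∀ s m c c′ → s ℕ.* m ℕ.* (c ℕ.* c′) ≡ m ℕ.* c ℕ.* (s ℕ.* c′)
  regroup = ℕ-solve-∀
  regroup′ : ∀ y c x c′ → y ℕ.* c ℕ.* (x ℕ.* c′) ≡ x ℕ.* y ℕ.* (c ℕ.* c′)
  regroup′ = ℕ-solve-∀

γ-suc-b : ∀ a b i → i ℕ.* γ a (suc b) (suc i) ℕ.+ suc b ℕ.* γ a b i ≡ (suc (suc b) ∸ i) ℕ.* γ a (suc b) i
γ-suc-b a b zero = trans (ℕ.*-zeroʳ (suc b)) (sym (ℕ.*-zeroʳ (suc (suc b))))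
γ-suc-b a b (suc j) with j ℕ.≤? a
... | no j≰a
  rewrite k>n⇒nCk≡0 (ℕ.≰⇒> j≰a) | k>n⇒nCk≡0 (ℕ.m<n⇒m<1+n (ℕ.≰⇒> j≰a))
  = vanish (suc j) ((a ℕ.+ suc b ∸ suc j) C a) (suc b) ((a ℕ.+ b ∸ j) C a) (suc b ∸ j) ((a ℕ.+ suc b ∸ j) C a)
  where
  vanish : ∀ s c t c′ u c″ → s ℕ.* (c ℕ.* 0) ℕ.+ t ℕ.* (c′ ℕ.* 0) ≡ u ℕ.* (c″ ℕ.* 0)
  vanish = ℕ-solve-∀
... | yes j≤a = begin
  suc j ℕ.* (((a ℕ.+ suc b ∸ suc j) C a) ℕ.* (a C suc j)) ℕ.+ suc b ℕ.* ((M C a) ℕ.* (a C j))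
      ≡⟨ cong (λ x → suc j ℕ.* ((x C a) ℕ.* (a C suc j)) ℕ.+ suc b ℕ.* ((M C a) ℕ.* (a C j)))
              (cong (_∸ suc j) (ℕ.+-suc a b)) ⟩
  suc j ℕ.* ((M C a) ℕ.* (a C suc j)) ℕ.+ suc b ℕ.* ((M C a) ℕ.* (a C j))
      ≡⟨ regroup (suc j) (M C a) (a C suc j) (suc b) (a C j) ⟩
  (M C a) ℕ.* (suc j ℕ.* (a C suc j)) ℕ.+ suc b ℕ.* (M C a) ℕ.* (a C j)
      ≡⟨ cong (λ x → (M C a) ℕ.* x ℕ.+ suc b ℕ.* (M C a) ℕ.* (a C j)) ([1+k]*nC[1+k]≡[n∸k]*nCk a j) ⟩
  (M C a) ℕ.* ((a ∸ j) ℕ.* (a C j)) ℕ.+ suc b ℕ.* (M C a) ℕ.* (a C j)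
      ≡⟨ regroup′ (M C a) (a ∸ j) (a C j) (suc b) ⟩
  ((a ∸ j) ℕ.+ suc b) ℕ.* (M C a) ℕ.* (a C j)
      ≡⟨ cong (λ x → x ℕ.* (M C a) ℕ.* (a C j)) (trans (sym (ℕ.+-∸-comm (suc b) j≤a)) N≡1+M) ⟩
  suc M ℕ.* (M C a) ℕ.* (a C j)
      ≡⟨ cong (ℕ._* (a C j)) (n*[n-1]Ck≡[n∸k]*nCk (suc M) a) ⟩
  (suc M ∸ a) ℕ.* (suc M C a) ℕ.* (a C j)
      ≡⟨ cong (λ x → (x ∸ a) ℕ.* (x C a) ℕ.* (a C j)) N≡1+M ⟨
  (N ∸ a) ℕ.* (N C a) ℕ.* (a C j)
      ≡⟨ cong (λ x → x ℕ.* (N C a) ℕ.* (a C j)) (a+b∸j∸a≡b∸j a (suc b) j) ⟩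
  (suc b ∸ j) ℕ.* (N C a) ℕ.* (a C j)
      ≡⟨ ℕ.*-assoc (suc b ∸ j) (N C a) (a C j) ⟩
  (suc b ∸ j) ℕ.* ((N C a) ℕ.* (a C j))
      ∎
  where
  open ≡-Reasoning
  M = a ℕ.+ b ∸ j
  N = a ℕ.+ suc b ∸ j
  N≡1+M : N ≡ suc M
  N≡1+M = trans (cong (_∸ j) (ℕ.+-suc a b)) (ℕ.+-∸-assoc 1 (ℕ.≤-trans j≤a (ℕ.m≤m+n a b)))
  regroup : ∀ s c c′ t c″ → s ℕ.* (c ℕ.* c′) ℕ.+ t ℕ.* (c ℕ.* c″) ≡ c ℕ.* (s ℕ.* c′) ℕ.+ t ℕ.* c ℕ.* c″
  regroup = ℕ-solve-∀
  regroup′ : ∀ c x c′ t → c ℕ.* (x ℕ.* c′) ℕ.+ t ℕ.* c ℕ.* c′ ≡ (x ℕ.+ t) ℕ.* c ℕ.* c′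
  regroup′ = ℕ-solve-∀

⟦γ⟧-ratio : ∀ a b {i} → i ≤ suc a → i ≤ suc b →
  ⟦ i ⟧ * (⟦ suc a ⟧ + ⟦ suc b ⟧ - 1ℚ - ⟦ i ⟧) * ⟦ γ a b (suc i) ⟧
    ≡ (⟦ suc a ⟧ - ⟦ i ⟧) * (⟦ suc b ⟧ - ⟦ i ⟧) * ⟦ γ a b i ⟧
⟦γ⟧-ratio a b {i} i≤1+a i≤1+b = begin
  ⟦ i ⟧ * (⟦ suc a ⟧ + ⟦ suc b ⟧ - 1ℚ - ⟦ i ⟧) * ⟦ γ a b (suc i) ⟧
    ≡⟨ cong (λ x → ⟦ i ⟧ * (x - ⟦ i ⟧) * ⟦ γ a b (suc i) ⟧) ⟦1+a+b⟧ ⟨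
  ⟦ i ⟧ * (⟦ suc (a ℕ.+ b) ⟧ - ⟦ i ⟧) * ⟦ γ a b (suc i) ⟧
    ≡⟨ cong (λ x → ⟦ i ⟧ * x * ⟦ γ a b (suc i) ⟧) (⟦∸⟧ i≤1+a+b) ⟨
  ⟦ i ⟧ * ⟦ suc (a ℕ.+ b) ∸ i ⟧ * ⟦ γ a b (suc i) ⟧
    ≡⟨ ⟦*⟧₃ i (suc (a ℕ.+ b) ∸ i) (γ a b (suc i)) ⟨
  ⟦ i ℕ.* (suc (a ℕ.+ b) ∸ i) ℕ.* γ a b (suc i) ⟧
    ≡⟨ cong ⟦_⟧ (γ-ratio a b i) ⟩
  ⟦ (suc a ∸ i) ℕ.* (suc b ∸ i) ℕ.* γ a b i ⟧
    ≡⟨ ⟦*⟧₃ (suc a ∸ i) (suc b ∸ i) (γ a b i) ⟩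
  ⟦ suc a ∸ i ⟧ * ⟦ suc b ∸ i ⟧ * ⟦ γ a b i ⟧
    ≡⟨ cong₂ (λ x y → x * y * ⟦ γ a b i ⟧) (⟦∸⟧ i≤1+a) (⟦∸⟧ i≤1+b) ⟩
  (⟦ suc a ⟧ - ⟦ i ⟧) * (⟦ suc b ⟧ - ⟦ i ⟧) * ⟦ γ a b i ⟧ ∎
  where
  open ≡-Reasoning
  i≤1+a+b : i ≤ suc (a ℕ.+ b)
  i≤1+a+b = ℕ.≤-trans i≤1+a (s≤s (ℕ.m≤m+n a b))
  shift : ∀ x y → x + y ≡ x + (1ℚ + y) - 1ℚ
  shift = solve-∀ ℚ-ring
  ⟦1+a+b⟧ : ⟦ suc (a ℕ.+ b) ⟧ ≡ ⟦ suc a ⟧ + ⟦ suc b ⟧ - 1ℚ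
  ⟦1+a+b⟧ = trans (⟦+⟧ (suc a) b)
    (trans (shift ⟦ suc a ⟧ ⟦ b ⟧) (cong (λ x → ⟦ suc a ⟧ + x - 1ℚ) (sym (⟦suc⟧ b))))

⟦γ⟧-suc-b : ∀ a b {i} → i ≤ suc (suc b) →
  ⟦ i ⟧ * ⟦ γ a (suc b) (suc i) ⟧ + (⟦ suc (suc b) ⟧ - 1ℚ) * ⟦ γ a b i ⟧
    ≡ (⟦ suc (suc b) ⟧ - ⟦ i ⟧) * ⟦ γ a (suc b) i ⟧
⟦γ⟧-suc-b a b {i} i≤2+b = begin
  ⟦ i ⟧ * ⟦ γ a (suc b) (suc i) ⟧ + (⟦ suc (suc b) ⟧ - 1ℚ) * ⟦ γ a b i ⟧
    ≡⟨ cong (λ x → ⟦ i ⟧ * ⟦ γ a (suc b) (suc i) ⟧ + x * ⟦ γ a b i ⟧) (⟦∸⟧ (s≤s (z≤n {suc b}))) ⟨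
  ⟦ i ⟧ * ⟦ γ a (suc b) (suc i) ⟧ + ⟦ suc b ⟧ * ⟦ γ a b i ⟧
    ≡⟨ cong₂ _+_ (⟦*⟧ i (γ a (suc b) (suc i))) (⟦*⟧ (suc b) (γ a b i)) ⟨
  ⟦ i ℕ.* γ a (suc b) (suc i) ⟧ + ⟦ suc b ℕ.* γ a b i ⟧
    ≡⟨ ⟦+⟧ (i ℕ.* γ a (suc b) (suc i)) (suc b ℕ.* γ a b i) ⟨
  ⟦ i ℕ.* γ a (suc b) (suc i) ℕ.+ suc b ℕ.* γ a b i ⟧
    ≡⟨ cong ⟦_⟧ (γ-suc-b a b i) ⟩
  ⟦ (suc (suc b) ∸ i) ℕ.* γ a (suc b) i ⟧
    ≡⟨ ⟦*⟧ (suc (suc b) ∸ i) (γ a (suc b) i) ⟩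
  ⟦ suc (suc b) ∸ i ⟧ * ⟦ γ a (suc b) i ⟧
    ≡⟨ cong (_* ⟦ γ a (suc b) i ⟧) (⟦∸⟧ i≤2+b) ⟩
  (⟦ suc (suc b) ⟧ - ⟦ i ⟧) * ⟦ γ a (suc b) i ⟧ ∎
  where open ≡-Reasoning

gCoeff≡⟦γ⟧ : ∀ {a b i} → i ≤ suc (a ℕ.⊓ b) → gCoeff (suc a ℕ.+ suc b) (suc a) i ≡ ⟦ γ a b i ⟧
gCoeff≡⟦γ⟧ {i = zero}        _           = refl
gCoeff≡⟦γ⟧ {a} {b} {suc j} (s≤s j≤a⊓b) = begin
  ⟦ (a ℕ.+ suc b ∸ j ∸ 1) ! ⟧ /' ⟦ (a ∸ j) ! ℕ.* (suc a ℕ.+ suc b ∸ suc a ∸ suc j) ! ℕ.* j ! ⟧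
    ≡⟨ cong₂ (λ x y → ⟦ x ! ⟧ /' ⟦ (a ∸ j) ! ℕ.* (y ∸ suc j) ! ℕ.* j ! ⟧) top (ℕ.m+n∸m≡n (suc a) (suc b)) ⟩
  ⟦ (a ℕ.+ b ∸ j) ! ⟧ /' ⟦ D ⟧
    ≡⟨ cong (λ x → ⟦ x ⟧ /' ⟦ D ⟧) (γ-factorial j≤a j≤b) ⟨
  ⟦ γ a b (suc j) ℕ.* D ⟧ /' ⟦ D ⟧
    ≡⟨ ⟦m*n⟧/'⟦n⟧≡⟦m⟧ (γ a b (suc j)) D {{ℕ.m*n≢0 _ _ {{(a ∸ j) ℕ.!* (b ∸ j) !≢0}} {{j ℕ.!≢0}}}} ⟩
  ⟦ γ a b (suc j) ⟧
    ∎
  where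
  open ≡-Reasoning
  j≤a = ℕ.≤-trans j≤a⊓b (ℕ.m⊓n≤m a b)
  j≤b = ℕ.≤-trans j≤a⊓b (ℕ.m⊓n≤n a b)
  D = (a ∸ j) ! ℕ.* (b ∸ j) ! ℕ.* j !
  top : a ℕ.+ suc b ∸ j ∸ 1 ≡ a ℕ.+ b ∸ j
  top = trans (ℕ.∸-+-assoc (a ℕ.+ suc b) j 1) (cong₂ _∸_ (ℕ.+-suc a b) (ℕ.+-comm j 1))

g-tabulate : ∀ a b → g (suc a ℕ.+ suc b) (suc a) ≡ applyUpTo (λ i → ⟦ γ a b i ⟧) (suc (suc (a ℕ.⊓ b)))
g-tabulate a b = begin
  map (gCoeff n (suc a)) (upTo (suc (suc a ℕ.⊓ (n ∸ suc a))))
    ≡⟨ cong (λ m → map (gCoeff n (suc a)) (upTo (suc (suc a ℕ.⊓ m)))) (ℕ.m+n∸m≡n (suc a) (suc b)) ⟩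
  map (gCoeff n (suc a)) (upTo L)
    ≡⟨ map-applyUpTo id (gCoeff n (suc a)) L ⟩
  applyUpTo (gCoeff n (suc a)) L
    ≡⟨ applyUpTo-cong L (λ i i<L → gCoeff≡⟦γ⟧ (ℕ.≤-pred i<L)) ⟩
  applyUpTo (λ i → ⟦ γ a b i ⟧) L ∎
  where
  open ≡-Reasoning
  n = suc a ℕ.+ suc b
  L = suc (suc (a ℕ.⊓ b))

eval-g : ∀ a b → eval (g (suc a ℕ.+ suc b) (suc a)) 1ℚ ≡ ∑[ i < suc (suc (a ℕ.⊓ b)) ] ⟦ γ a b i ⟧
eval-g a b = trans (cong (λ p → eval p 1ℚ) (g-tabulate a b))
                   (eval-applyUpTo (λ i → ⟦ γ a b i ⟧) (suc (suc (a ℕ.⊓ b))))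

eval-deriv-g : ∀ a b → eval (deriv (g (suc a ℕ.+ suc b) (suc a))) 1ℚ
                       ≡ ∑[ i < suc (suc (a ℕ.⊓ b)) ] (⟦ i ⟧ * ⟦ γ a b i ⟧)
eval-deriv-g a b = trans (cong (λ p → eval (deriv p) 1ℚ) (g-tabulate a b))
                         (eval-deriv-applyUpTo (λ i → ⟦ γ a b i ⟧) (suc (suc (a ℕ.⊓ b))))

eval-deriv²-g : ∀ a b → eval (deriv (deriv (g (suc a ℕ.+ suc b) (suc a)))) 1ℚ
                        ≡ ∑[ i < suc (suc (a ℕ.⊓ b)) ] (⟦ i ⟧ * (⟦ i ⟧ - 1ℚ) * ⟦ γ a b i ⟧)
eval-deriv²-g a b = trans (cong (λ p → eval (deriv (deriv p)) 1ℚ) (g-tabulate a b))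
                          (eval-deriv²-applyUpTo (λ i → ⟦ γ a b i ⟧) (suc (suc (a ℕ.⊓ b))))

eval-g>0 : ∀ a b → 0ℚ ℚ.< eval (g (suc a ℕ.+ suc b) (suc a)) 1ℚ
eval-g>0 a b = subst (0ℚ ℚ.<_) (sym (eval-g a b))
  (∑-pos (λ i → ⟦⟧-nonNeg (γ a b i)) (⟦⟧-pos (γ a b 1) {{γ-1≢0 a b}})
         (suc (suc (a ℕ.⊓ b))) (s≤s (s≤s z≤n)))

-- Linear relations between g(1), g′(1) and g″(1)

γ-moment₂ : ∀ a b →
  let L = suc (suc (a ℕ.⊓ b)); e = λ i → ⟦ γ a b i ⟧; δ = ⟦ suc a ⟧; κ = ⟦ suc b ⟧ in
  ⟦ 2 ⟧ * ∑[ i < L ] (⟦ i ⟧ * (⟦ i ⟧ - 1ℚ) * e i) + (δ * κ + δ + κ) * ∑ L e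
    ≡ (⟦ 2 ⟧ * (δ + κ) - 1ℚ) * ∑[ i < L ] (⟦ i ⟧ * e i)
γ-moment₂ a b = begin
  ⟦ 2 ⟧ * ∑ L A + K₁ * ∑ L e
    ≡⟨ trans (∑-+ L _ _) (cong₂ _+_ (∑-*ˡ L ⟦ 2 ⟧ A) (∑-*ˡ L K₁ e)) ⟨
  ∑[ i < L ] (⟦ 2 ⟧ * A i + K₁ * e i)
    ≡⟨ ∑-telescoping-cong L F (ℚ.*-zeroʳ ((⟦ 0 ⟧ - 1ℚ) * (δ + κ - ⟦ 0 ⟧))) FL≡0 step ⟩
  ∑[ i < L ] (K₂ * B i)
    ≡⟨ ∑-*ˡ L K₂ B ⟩
  K₂ * ∑ L B ∎
  where
  open ≡-Reasoning
  L = suc (suc (a ℕ.⊓ b))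
  e = λ i → ⟦ γ a b i ⟧
  δ = ⟦ suc a ⟧
  κ = ⟦ suc b ⟧
  K₁ = δ * κ + δ + κ
  K₂ = ⟦ 2 ⟧ * (δ + κ) - 1ℚ
  A = λ i → ⟦ i ⟧ * (⟦ i ⟧ - 1ℚ) * e i
  B = λ i → ⟦ i ⟧ * e i
  -- F (suc i) is the left-hand side of ⟦γ⟧-ratio.
  F = λ i → (⟦ i ⟧ - 1ℚ) * (δ + κ - ⟦ i ⟧) * e i
  FL≡0 : F L ≡ 0ℚ
  FL≡0 = trans (cong (λ x → (⟦ L ⟧ - 1ℚ) * (δ + κ - ⟦ L ⟧) * ⟦ x ⟧) (γ-vanishes {a} {b} ℕ.≤-refl))
               (ℚ.*-zeroʳ ((⟦ L ⟧ - 1ℚ) * (δ + κ - ⟦ L ⟧)))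
  shift : ∀ x d k y → (1ℚ + x - 1ℚ) * (d + k - (1ℚ + x)) * y ≡ x * (d + k - 1ℚ - x) * y
  shift = solve-∀ ℚ-ring
  expand : ∀ x d k y →
    ⟦ 2 ⟧ * (x * (x - 1ℚ) * y) + (d * k + d + k) * y
      ≡ (⟦ 2 ⟧ * (d + k) - 1ℚ) * (x * y) + ((d - x) * (k - x) * y - (x - 1ℚ) * (d + k - x) * y)
  expand = solve-∀ ℚ-ring
  step : ∀ i → i < L → ⟦ 2 ⟧ * A i + K₁ * e i ≡ K₂ * B i + (F (suc i) - F i)
  step i i<L = begin
    ⟦ 2 ⟧ * A i + K₁ * e i
      ≡⟨ expand ⟦ i ⟧ δ κ (e i) ⟩
    K₂ * B i + ((δ - ⟦ i ⟧) * (κ - ⟦ i ⟧) * e i - F i)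
      ≡⟨ cong (λ x → K₂ * B i + (x - F i)) (⟦γ⟧-ratio a b i≤1+a i≤1+b) ⟨
    K₂ * B i + (⟦ i ⟧ * (δ + κ - 1ℚ - ⟦ i ⟧) * e (suc i) - F i)
      ≡⟨ cong (λ x → K₂ * B i + (x - F i)) (shift ⟦ i ⟧ δ κ (e (suc i))) ⟨
    K₂ * B i + ((1ℚ + ⟦ i ⟧ - 1ℚ) * (δ + κ - (1ℚ + ⟦ i ⟧)) * e (suc i) - F i)
      ≡⟨ cong (λ x → K₂ * B i + ((x - 1ℚ) * (δ + κ - x) * e (suc i) - F i)) (⟦suc⟧ i) ⟨
    K₂ * B i + (F (suc i) - F i) ∎
    where
    i≤1+a = ℕ.≤-trans (ℕ.≤-pred i<L) (s≤s (ℕ.m⊓n≤m a b))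
    i≤1+b = ℕ.≤-trans (ℕ.≤-pred i<L) (s≤s (ℕ.m⊓n≤n a b))

γ-moment₁ : ∀ a b →
  let L = suc (suc (a ℕ.⊓ suc b)); e = λ i → ⟦ γ a (suc b) i ⟧; κ = ⟦ suc (suc b) ⟧ in
  ⟦ 2 ⟧ * ∑[ i < L ] (⟦ i ⟧ * e i) + (κ - 1ℚ) * ∑[ i < suc (suc (a ℕ.⊓ b)) ] ⟦ γ a b i ⟧
    ≡ (κ + 1ℚ) * ∑ L e
γ-moment₁ a b = begin
  ⟦ 2 ⟧ * ∑ L B + (κ - 1ℚ) * ∑ L₀ e₀
    ≡⟨ cong (λ x → ⟦ 2 ⟧ * ∑ L B + (κ - 1ℚ) * x) (∑-vanishing-tail e₀≡0 L L₀≤L) ⟨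
  ⟦ 2 ⟧ * ∑ L B + (κ - 1ℚ) * ∑ L e₀
    ≡⟨ trans (∑-+ L _ _) (cong₂ _+_ (∑-*ˡ L ⟦ 2 ⟧ B) (∑-*ˡ L (κ - 1ℚ) e₀)) ⟨
  ∑[ i < L ] (⟦ 2 ⟧ * B i + (κ - 1ℚ) * e₀ i)
    ≡⟨ ∑-telescoping-cong L F (ℚ.*-zeroʳ (1ℚ - ⟦ 0 ⟧)) FL≡0 step ⟩
  ∑[ i < L ] ((κ + 1ℚ) * e i)
    ≡⟨ ∑-*ˡ L (κ + 1ℚ) e ⟩
  (κ + 1ℚ) * ∑ L e ∎
  where
  open ≡-Reasoning
  L = suc (suc (a ℕ.⊓ suc b))
  L₀ = suc (suc (a ℕ.⊓ b))
  L₀≤L : L₀ ≤ L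
  L₀≤L = s≤s (s≤s (ℕ.⊓-monoʳ-≤ a (ℕ.n≤1+n b)))
  e = λ i → ⟦ γ a (suc b) i ⟧
  e₀ = λ i → ⟦ γ a b i ⟧
  e₀≡0 : ∀ i → L₀ ≤ i → e₀ i ≡ 0ℚ
  e₀≡0 i L₀≤i = cong ⟦_⟧ (γ-vanishes L₀≤i)
  κ = ⟦ suc (suc b) ⟧
  B = λ i → ⟦ i ⟧ * e i
  -- F (suc i) is minus the first term of ⟦γ⟧-suc-b.
  F = λ i → (1ℚ - ⟦ i ⟧) * e i
  FL≡0 : F L ≡ 0ℚ
  FL≡0 = trans (cong (λ x → (1ℚ - ⟦ L ⟧) * ⟦ x ⟧) (γ-vanishes {a} {suc b} ℕ.≤-refl))
               (ℚ.*-zeroʳ (1ℚ - ⟦ L ⟧))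
  isolate : ∀ x y z w k → ⟦ 2 ⟧ * (x * y) + k * z ≡ ⟦ 2 ⟧ * (x * y) + (x * w + k * z) - x * w
  isolate = solve-∀ ℚ-ring
  collect : ∀ x y w k →
    ⟦ 2 ⟧ * (x * y) + (k - x) * y - x * w ≡ (k + 1ℚ) * y + ((1ℚ - (1ℚ + x)) * w - (1ℚ - x) * y)
  collect = solve-∀ ℚ-ring
  step : ∀ i → i < L → ⟦ 2 ⟧ * B i + (κ - 1ℚ) * e₀ i ≡ (κ + 1ℚ) * e i + (F (suc i) - F i)
  step i i<L = begin
    ⟦ 2 ⟧ * B i + (κ - 1ℚ) * e₀ i
      ≡⟨ isolate ⟦ i ⟧ (e i) (e₀ i) (e (suc i)) (κ - 1ℚ) ⟩
    ⟦ 2 ⟧ * B i + (⟦ i ⟧ * e (suc i) + (κ - 1ℚ) * e₀ i) - ⟦ i ⟧ * e (suc i)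
      ≡⟨ cong (λ x → ⟦ 2 ⟧ * B i + x - ⟦ i ⟧ * e (suc i)) (⟦γ⟧-suc-b a b i≤2+b) ⟩
    ⟦ 2 ⟧ * B i + (κ - ⟦ i ⟧) * e i - ⟦ i ⟧ * e (suc i)
      ≡⟨ collect ⟦ i ⟧ (e i) (e (suc i)) κ ⟩
    (κ + 1ℚ) * e i + ((1ℚ - (1ℚ + ⟦ i ⟧)) * e (suc i) - F i)
      ≡⟨ cong (λ x → (κ + 1ℚ) * e i + ((1ℚ - x) * e (suc i) - F i)) (⟦suc⟧ i) ⟨
    (κ + 1ℚ) * e i + (F (suc i) - F i) ∎
    where
    i≤2+b = ℕ.≤-trans (ℕ.≤-pred i<L) (s≤s (ℕ.m⊓n≤n a (suc b)))

g-moment₂ : ∀ a b → let p = g (suc a ℕ.+ suc b) (suc a); δ = ⟦ suc a ⟧; κ = ⟦ suc b ⟧ in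
  ⟦ 2 ⟧ * eval (deriv (deriv p)) 1ℚ + (δ * κ + δ + κ) * eval p 1ℚ ≡ (⟦ 2 ⟧ * (δ + κ) - 1ℚ) * eval (deriv p) 1ℚ
g-moment₂ a b = begin
  ⟦ 2 ⟧ * eval (deriv (deriv p)) 1ℚ + K₁ * eval p 1ℚ
    ≡⟨ cong₂ (λ x y → ⟦ 2 ⟧ * x + K₁ * y) (eval-deriv²-g a b) (eval-g a b) ⟩
  ⟦ 2 ⟧ * ∑[ i < L ] (⟦ i ⟧ * (⟦ i ⟧ - 1ℚ) * e i) + K₁ * ∑ L e
    ≡⟨ γ-moment₂ a b ⟩
  K₂ * ∑[ i < L ] (⟦ i ⟧ * e i)
    ≡⟨ cong (K₂ *_) (eval-deriv-g a b) ⟨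
  K₂ * eval (deriv p) 1ℚ ∎
  where
  open ≡-Reasoning
  p = g (suc a ℕ.+ suc b) (suc a)
  L = suc (suc (a ℕ.⊓ b))
  e = λ i → ⟦ γ a b i ⟧
  K₁ = ⟦ suc a ⟧ * ⟦ suc b ⟧ + ⟦ suc a ⟧ + ⟦ suc b ⟧
  K₂ = ⟦ 2 ⟧ * (⟦ suc a ⟧ + ⟦ suc b ⟧) - 1ℚ

g-moment₁ : ∀ a b →
  let p = g (suc a ℕ.+ suc (suc b)) (suc a); q = g (suc a ℕ.+ suc b) (suc a); κ = ⟦ suc (suc b) ⟧ in
  ⟦ 2 ⟧ * eval (deriv p) 1ℚ + (κ - 1ℚ) * eval q 1ℚ ≡ (κ + 1ℚ) * eval p 1ℚ
g-moment₁ a b = begin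
  ⟦ 2 ⟧ * eval (deriv p) 1ℚ + (κ - 1ℚ) * eval q 1ℚ
    ≡⟨ cong₂ (λ x y → ⟦ 2 ⟧ * x + (κ - 1ℚ) * y) (eval-deriv-g a (suc b)) (eval-g a b) ⟩
  ⟦ 2 ⟧ * ∑[ i < L ] (⟦ i ⟧ * e i) + (κ - 1ℚ) * ∑[ i < L₀ ] ⟦ γ a b i ⟧
    ≡⟨ γ-moment₁ a b ⟩
  (κ + 1ℚ) * ∑ L e
    ≡⟨ cong ((κ + 1ℚ) *_) (eval-g a (suc b)) ⟨
  (κ + 1ℚ) * eval p 1ℚ ∎
  where
  open ≡-Reasoning
  p = g (suc a ℕ.+ suc (suc b)) (suc a)
  q = g (suc a ℕ.+ suc b) (suc a)
  κ = ⟦ suc (suc b) ⟧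
  L = suc (suc (a ℕ.⊓ suc b))
  L₀ = suc (suc (a ℕ.⊓ b))
  e = λ i → ⟦ γ a (suc b) i ⟧

mean : Poly → ℚ
mean p = eval (deriv p) 1ℚ /' eval p 1ℚ

variance : Poly → ℚ
variance p = (eval (deriv (deriv p)) 1ℚ /' eval p 1ℚ) + mean p - mean p * mean p

¼ : ℚ
¼ = 1/ ⟦ 4 ⟧

variance-identity : ∀ {δ κ q₁ q₂ r} →
  q₁ + q₁ ≡ κ + 1ℚ - (κ - 1ℚ) * r →
  q₂ + q₂ ≡ (⟦ 2 ⟧ * (δ + κ) - 1ℚ) * q₁ - (δ * κ + δ + κ) →
  q₂ + q₁ - q₁ * q₁
    ≡ κ * (κ - 1ℚ) * ¼ - (κ - 1ℚ) * (⟦ 2 ⟧ * δ - 1ℚ) * ¼ * r - (κ - 1ℚ) * (κ - 1ℚ) * ¼ * (r * r)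
variance-identity {δ} {κ} {q₁} {q₂} {r} 2q₁≡ 2q₂≡ = begin
  q₂ + q₁ - q₁ * q₁
    ≡⟨ quadruple q₁ q₂ ⟩
  ¼ * ((q₂ + q₂) + (q₂ + q₂) + (q₁ + q₁) + (q₁ + q₁) - (q₁ + q₁) * (q₁ + q₁))
    ≡⟨ cong (λ x → ¼ * (x + x + (q₁ + q₁) + (q₁ + q₁) - (q₁ + q₁) * (q₁ + q₁))) 2q₂≡ ⟩
  ¼ * ((K₂ * q₁ - K₁) + (K₂ * q₁ - K₁) + (q₁ + q₁) + (q₁ + q₁) - (q₁ + q₁) * (q₁ + q₁))
    ≡⟨ regroup δ κ q₁ ⟩
  ¼ * (K₂ * (q₁ + q₁) - (K₁ + K₁) + (q₁ + q₁) + (q₁ + q₁) - (q₁ + q₁) * (q₁ + q₁))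
    ≡⟨ cong (λ z → ¼ * (K₂ * z - (K₁ + K₁) + z + z - z * z)) 2q₁≡ ⟩
  ¼ * (K₂ * Z - (K₁ + K₁) + Z + Z - Z * Z)
    ≡⟨ expand δ κ r ⟩
  κ * (κ - 1ℚ) * ¼ - (κ - 1ℚ) * (⟦ 2 ⟧ * δ - 1ℚ) * ¼ * r - (κ - 1ℚ) * (κ - 1ℚ) * ¼ * (r * r) ∎
  where
  open ≡-Reasoning
  K₁ = δ * κ + δ + κ
  K₂ = ⟦ 2 ⟧ * (δ + κ) - 1ℚ
  Z = κ + 1ℚ - (κ - 1ℚ) * r
  quadruple : ∀ x y → y + x - x * x ≡ ¼ * ((y + y) + (y + y) + (x + x) + (x + x) - (x + x) * (x + x))
  quadruple = solve-∀ ℚ-ring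
  regroup : ∀ d k x → let K₁ = d * k + d + k; K₂ = ⟦ 2 ⟧ * (d + k) - 1ℚ in
    ¼ * ((K₂ * x - K₁) + (K₂ * x - K₁) + (x + x) + (x + x) - (x + x) * (x + x))
      ≡ ¼ * (K₂ * (x + x) - (K₁ + K₁) + (x + x) + (x + x) - (x + x) * (x + x))
  regroup = solve-∀ ℚ-ring
  expand : ∀ d k r → let K₁ = d * k + d + k; K₂ = ⟦ 2 ⟧ * (d + k) - 1ℚ; Z = k + 1ℚ - (k - 1ℚ) * r in
    ¼ * (K₂ * Z - (K₁ + K₁) + Z + Z - Z * Z)
      ≡ k * (k - 1ℚ) * ¼ - (k - 1ℚ) * (⟦ 2 ⟧ * d - 1ℚ) * ¼ * r - (k - 1ℚ) * (k - 1ℚ) * ¼ * (r * r)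
  expand = solve-∀ ℚ-ring

closed-form : ℕ → ℕ → ℚ → ℚ
closed-form c d r = (⟦ c ℕ.* (c ∸ 1) ⟧ /' ⟦ 4 ⟧)
                    - ((⟦ (c ∸ 1) ℕ.* (2 ℕ.* d ∸ 1) ⟧ /' ⟦ 4 ⟧) * r)
                    - ((⟦ (c ∸ 1) ℕ.* (c ∸ 1) ⟧ /' ⟦ 4 ⟧) * (r * r))

closed-form-⟦⟧ : ∀ {c d} r → 1 ≤ c → 1 ≤ d → let κ = ⟦ c ⟧; δ = ⟦ d ⟧ in
  closed-form c d r ≡ (κ * (κ - 1ℚ)) /' ⟦ 4 ⟧ - ((κ - 1ℚ) * (⟦ 2 ⟧ * δ - 1ℚ)) /' ⟦ 4 ⟧ * r
                      - ((κ - 1ℚ) * (κ - 1ℚ)) /' ⟦ 4 ⟧ * (r * r)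
closed-form-⟦⟧ {c} {d} r 1≤c 1≤d = begin
  closed-form c d r
    ≡⟨ cong₂ (λ x y → x /' ⟦ 4 ⟧ - y /' ⟦ 4 ⟧ * r - ⟦ (c ∸ 1) ℕ.* (c ∸ 1) ⟧ /' ⟦ 4 ⟧ * (r * r))
             ⟦c*[c∸1]⟧ ⟦[c∸1]*[2d∸1]⟧ ⟩
  X₁ /' ⟦ 4 ⟧ - X₂ /' ⟦ 4 ⟧ * r - ⟦ (c ∸ 1) ℕ.* (c ∸ 1) ⟧ /' ⟦ 4 ⟧ * (r * r)
    ≡⟨ cong (λ x → X₁ /' ⟦ 4 ⟧ - X₂ /' ⟦ 4 ⟧ * r - x /' ⟦ 4 ⟧ * (r * r)) ⟦[c∸1]*[c∸1]⟧ ⟩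
  X₁ /' ⟦ 4 ⟧ - X₂ /' ⟦ 4 ⟧ * r - X₃ /' ⟦ 4 ⟧ * (r * r) ∎
  where
  open ≡-Reasoning
  κ = ⟦ c ⟧
  δ = ⟦ d ⟧
  X₁ = κ * (κ - 1ℚ)
  X₂ = (κ - 1ℚ) * (⟦ 2 ⟧ * δ - 1ℚ)
  X₃ = (κ - 1ℚ) * (κ - 1ℚ)
  ⟦c∸1⟧ : ⟦ c ∸ 1 ⟧ ≡ κ - 1ℚ
  ⟦c∸1⟧ = ⟦∸⟧ 1≤c
  ⟦c*[c∸1]⟧ : ⟦ c ℕ.* (c ∸ 1) ⟧ ≡ X₁
  ⟦c*[c∸1]⟧ = trans (⟦*⟧ c (c ∸ 1)) (cong (κ *_) ⟦c∸1⟧)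
  ⟦2d∸1⟧ : ⟦ 2 ℕ.* d ∸ 1 ⟧ ≡ ⟦ 2 ⟧ * δ - 1ℚ
  ⟦2d∸1⟧ = trans (⟦∸⟧ (ℕ.≤-trans 1≤d (ℕ.m≤n*m d 2))) (cong (_- 1ℚ) (⟦*⟧ 2 d))
  ⟦[c∸1]*[2d∸1]⟧ : ⟦ (c ∸ 1) ℕ.* (2 ℕ.* d ∸ 1) ⟧ ≡ X₂
  ⟦[c∸1]*[2d∸1]⟧ = trans (⟦*⟧ (c ∸ 1) (2 ℕ.* d ∸ 1)) (cong₂ _*_ ⟦c∸1⟧ ⟦2d∸1⟧)
  ⟦[c∸1]*[c∸1]⟧ : ⟦ (c ∸ 1) ℕ.* (c ∸ 1) ⟧ ≡ X₃
  ⟦[c∸1]*[c∸1]⟧ = trans (⟦*⟧ (c ∸ 1) (c ∸ 1)) (cong₂ _*_ ⟦c∸1⟧ ⟦c∸1⟧)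

variance-from-moments : ∀ {p q : Poly} {d c} → 1 ≤ d → 1 ≤ c → 0ℚ ℚ.< eval p 1ℚ →
  let δ = ⟦ d ⟧; κ = ⟦ c ⟧ in
  ⟦ 2 ⟧ * eval (deriv (deriv p)) 1ℚ + (δ * κ + δ + κ) * eval p 1ℚ
    ≡ (⟦ 2 ⟧ * (δ + κ) - 1ℚ) * eval (deriv p) 1ℚ →
  ⟦ 2 ⟧ * eval (deriv p) 1ℚ + (κ - 1ℚ) * eval q 1ℚ ≡ (κ + 1ℚ) * eval p 1ℚ →
  variance p ≡ closed-form c d (eval q 1ℚ /' eval p 1ℚ)
variance-from-moments {p} {q} {d} {c} 1≤d 1≤c P>0 moment₂ moment₁ = begin
  variance p
    ≡⟨ cong₂ (λ x y → x + y - y * y) (/'≡*1/ Q₂ P>0) (/'≡*1/ Q₁ P>0) ⟩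
  Q₂ * w + Q₁ * w - Q₁ * w * (Q₁ * w)
    ≡⟨ variance-identity {δ} {κ} {Q₁ * w} {Q₂ * w} {T * w} 2q₁≡ 2q₂≡ ⟩
  X₁ * ¼ - X₂ * ¼ * (T * w) - X₃ * ¼ * (T * w * (T * w))
    ≡⟨ cong₂ (λ x t → x - X₂ * ¼ * t - X₃ * ¼ * (t * t)) (/'≡*1/ X₁ 4>0) (/'≡*1/ T P>0) ⟨
  X₁ /' ⟦ 4 ⟧ - X₂ * ¼ * r - X₃ * ¼ * (r * r)
    ≡⟨ cong₂ (λ x y → X₁ /' ⟦ 4 ⟧ - x * r - y * (r * r)) (/'≡*1/ X₂ 4>0) (/'≡*1/ X₃ 4>0) ⟨
  X₁ /' ⟦ 4 ⟧ - X₂ /' ⟦ 4 ⟧ * r - X₃ /' ⟦ 4 ⟧ * (r * r)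
    ≡⟨ closed-form-⟦⟧ r 1≤c 1≤d ⟨
  closed-form c d r ∎
  where
  open ≡-Reasoning
  δ = ⟦ d ⟧
  κ = ⟦ c ⟧
  P = eval p 1ℚ
  Q₁ = eval (deriv p) 1ℚ
  Q₂ = eval (deriv (deriv p)) 1ℚ
  T = eval q 1ℚ
  r = T /' P
  K₁ = δ * κ + δ + κ
  K₂ = ⟦ 2 ⟧ * (δ + κ) - 1ℚ
  X₁ = κ * (κ - 1ℚ)
  X₂ = (κ - 1ℚ) * (⟦ 2 ⟧ * δ - 1ℚ)
  X₃ = (κ - 1ℚ) * (κ - 1ℚ)
  4>0 : 0ℚ ℚ.< ⟦ 4 ⟧
  4>0 = ⟦⟧-pos 4
  instance _ = ℚ.>-nonZero P>0
  w = 1/ P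
  Pw≡1 : P * w ≡ 1ℚ
  Pw≡1 = ℚ.*-inverseʳ P
  split₁ : ∀ x t k w → x * w + x * w ≡ (⟦ 2 ⟧ * x + (k - 1ℚ) * t) * w - (k - 1ℚ) * (t * w)
  split₁ = solve-∀ ℚ-ring
  split₂ : ∀ x p c w → x * w + x * w ≡ (⟦ 2 ⟧ * x + c * p) * w - c * (p * w)
  split₂ = solve-∀ ℚ-ring
  2q₁≡ : Q₁ * w + Q₁ * w ≡ κ + 1ℚ - (κ - 1ℚ) * (T * w)
  2q₁≡ = begin
    Q₁ * w + Q₁ * w                                       ≡⟨ split₁ Q₁ T κ w ⟩
    (⟦ 2 ⟧ * Q₁ + (κ - 1ℚ) * T) * w - (κ - 1ℚ) * (T * w)  ≡⟨ cong (λ x → x * w - (κ - 1ℚ) * (T * w)) moment₁ ⟩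
    (κ + 1ℚ) * P * w - (κ - 1ℚ) * (T * w)                 ≡⟨ cong (_- (κ - 1ℚ) * (T * w)) (ℚ.*-assoc (κ + 1ℚ) P w) ⟩
    (κ + 1ℚ) * (P * w) - (κ - 1ℚ) * (T * w)               ≡⟨ cong (λ x → (κ + 1ℚ) * x - (κ - 1ℚ) * (T * w)) Pw≡1 ⟩
    (κ + 1ℚ) * 1ℚ - (κ - 1ℚ) * (T * w)                    ≡⟨ cong (_- (κ - 1ℚ) * (T * w)) (ℚ.*-identityʳ (κ + 1ℚ)) ⟩
    κ + 1ℚ - (κ - 1ℚ) * (T * w)                           ∎
  2q₂≡ : Q₂ * w + Q₂ * w ≡ K₂ * (Q₁ * w) - K₁
  2q₂≡ = begin
    Q₂ * w + Q₂ * w                           ≡⟨ split₂ Q₂ P K₁ w ⟩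
    (⟦ 2 ⟧ * Q₂ + K₁ * P) * w - K₁ * (P * w)  ≡⟨ cong₂ (λ x y → x * w - K₁ * y) moment₂ Pw≡1 ⟩
    K₂ * Q₁ * w - K₁ * 1ℚ                     ≡⟨ cong₂ _-_ (ℚ.*-assoc K₂ Q₁ w) (ℚ.*-identityʳ K₁) ⟩
    K₂ * (Q₁ * w) - K₁                        ∎

variance-g≡closed-form : ∀ {n d c} → d ℕ.+ c ≡ n → 1 ≤ d → 2 ≤ c →
  variance (g n d) ≡ closed-form c d (eval (g (n ∸ 1) d) 1ℚ /' eval (g n d) 1ℚ)
variance-g≡closed-form {d = suc a} {c = suc (suc b)} refl (s≤s z≤n) (s≤s (s≤s z≤n)) =
  variance-from-moments {p} {q} {suc a} {suc (suc b)} (s≤s z≤n) (s≤s z≤n) (eval-g>0 a (suc b)) (g-moment₂ a (suc b)) moment₁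
  where
  p = g (suc a ℕ.+ suc (suc b)) (suc a)
  q = g (a ℕ.+ suc (suc b)) (suc a)
  κ = ⟦ suc (suc b) ⟧
  moment₁ : ⟦ 2 ⟧ * eval (deriv p) 1ℚ + (κ - 1ℚ) * eval q 1ℚ ≡ (κ + 1ℚ) * eval p 1ℚ
  moment₁ = subst (λ m → ⟦ 2 ⟧ * eval (deriv p) 1ℚ + (κ - 1ℚ) * eval (g m (suc a)) 1ℚ ≡ (κ + 1ℚ) * eval p 1ℚ)
                  (sym (ℕ.+-suc a (suc b))) (g-moment₁ a b)

-- Symmetry of g

gCoeff-sym : ∀ {n d} → d ≤ n → ∀ i → gCoeff n (n ∸ d) i ≡ gCoeff n d i
gCoeff-sym d≤n zero    = refl
gCoeff-sym {n} {d} d≤n (suc j) =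
  cong (λ x → ⟦ (n ∸ suc j ∸ 1) ! ⟧ /' ⟦ x ℕ.* j ! ⟧)
       (trans (cong (λ e → (n ∸ d ∸ suc j) ! ℕ.* (e ∸ suc j) !) (ℕ.m∸[m∸n]≡n d≤n))
              (ℕ.*-comm ((n ∸ d ∸ suc j) !) ((d ∸ suc j) !)))

g-sym : ∀ {n d} → d ≤ n → g n (n ∸ d) ≡ g n d
g-sym {n} {d} d≤n = begin
  map (gCoeff n (n ∸ d)) (upTo (suc ((n ∸ d) ℕ.⊓ (n ∸ (n ∸ d)))))
    ≡⟨ map-cong (gCoeff-sym d≤n) (upTo (suc ((n ∸ d) ℕ.⊓ (n ∸ (n ∸ d))))) ⟩
  map (gCoeff n d) (upTo (suc ((n ∸ d) ℕ.⊓ (n ∸ (n ∸ d)))))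
    ≡⟨ cong (λ m → map (gCoeff n d) (upTo (suc ((n ∸ d) ℕ.⊓ m)))) (ℕ.m∸[m∸n]≡n d≤n) ⟩
  map (gCoeff n d) (upTo (suc ((n ∸ d) ℕ.⊓ d)))
    ≡⟨ cong (λ m → map (gCoeff n d) (upTo (suc m))) (ℕ.⊓-comm (n ∸ d) d) ⟩
  map (gCoeff n d) (upTo (suc (d ℕ.⊓ (n ∸ d)))) ∎
  where open ≡-Reasoning

f[n∸1]≡g[n∸1,⌊n/2⌋] : ∀ {n} → 1 ≤ n → f (n ∸ 1) ≡ g (n ∸ 1) ⌊ n /2⌋
f[n∸1]≡g[n∸1,⌊n/2⌋] {suc m} _ = begin
  g m ⌊ m /2⌋        ≡⟨ cong (g m) ⌊m/2⌋≡m∸⌈m/2⌉ ⟩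
  g m (m ∸ ⌈ m /2⌉)  ≡⟨ g-sym (ℕ.⌈n/2⌉≤n m) ⟩
  g m ⌈ m /2⌉        ∎
  where
  open ≡-Reasoning
  ⌊m/2⌋≡m∸⌈m/2⌉ : ⌊ m /2⌋ ≡ m ∸ ⌈ m /2⌉
  ⌊m/2⌋≡m∸⌈m/2⌉ = trans (sym (ℕ.m+n∸n≡m ⌊ m /2⌋ ⌈ m /2⌉)) (cong (_∸ ⌈ m /2⌉) (ℕ.⌊n/2⌋+⌈n/2⌉≡n m))

lemma4p5 : (n : ℕ) → 3 ≤ n →
  let r = eval (f (n ∸ 1)) 1ℚ /' eval (f n) 1ℚ
      c = ⌈ n /2⌉
      fl = ⌊ n /2⌋
  in σ² n ≡ (⟦ c Data.Nat.* (c ∸ 1) ⟧ /' ⟦ 4 ⟧)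
            - ((⟦ (c ∸ 1) Data.Nat.* (2 Data.Nat.* fl ∸ 1) ⟧ /' ⟦ 4 ⟧) * r)
            - ((⟦ (c ∸ 1) Data.Nat.* (c ∸ 1) ⟧ /' ⟦ 4 ⟧) * (r * r))
lemma4p5 n 3≤n =
  subst (λ q → σ² n ≡ closed-form ⌈ n /2⌉ ⌊ n /2⌋ (eval q 1ℚ /' eval (f n) 1ℚ))
        (sym (f[n∸1]≡g[n∸1,⌊n/2⌋] (ℕ.≤-trans (s≤s z≤n) 3≤n)))
        (variance-g≡closed-form (ℕ.⌊n/2⌋+⌈n/2⌉≡n n) (ℕ.⌊n/2⌋-mono {2} 2≤n) (ℕ.⌈n/2⌉-mono {3} 3≤n))
  where
  2≤n : 2 ≤ n
  2≤n = ℕ.≤-trans (s≤s (s≤s z≤n)) 3≤n
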